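{- Let $T$ be a finite rooted tree in which every inner node has at least two children, let $L$ be its set of leaves and $V$ its set of nodes. Let $S\subseteq V\setminus L$, and let $(\pi,\sigma)$ and $(\pi',\sigma')$ be two pairs of injective maps from $S$ to $L$, each identifying $S$ with unique request. If $\pi(S)=\pi'(S)$ and $\sigma(S)=\sigma'(S)$, then $\pi=\pi'$ and $\sigma=\sigma'$.
   Context: Every node is an ancestor of itself. A pair $(\pi,\sigma)$ of injective maps from $S$ to $L$ identifies $S$ if for each $s\in S$, $s$ is the least common ancestor of $\pi(s)$ and $\sigma(s)$. For $s\in S$ and a node $x$, $x$ is $s$-requested in $(\pi,\sigma)$ if $x$ lies on the path from $\pi(s)$ to $\sigma(s)$ in $T$. The pair $(\pi,\sigma)$ has unique request if every node of $T$ is $s$-requested for at most one $s\in S$. -}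

module Defs where

open import Data.Nat using (ℕ; _≤_)
open import Data.Fin using (Fin)
open import Data.List using (List; []; length; lookup)
open import Data.List.Relation.Unary.All using (All)
open import Data.Product using (_×_; Σ; ∃)
open import Data.Sum using (_⊎_)
open import Relation.Nullary using (¬_)
open import Relation.Binary.PropositionalEquality using (_≡_)

data Tree : Set where
  node : List Tree → Tree

data Full : Tree → Set where
  full : ∀ {ts} → (ts ≡ [] ⊎ 2 ≤ length ts) → All Full ts → Full (node ts)

-- Nodes of a tree, as positions (root, or a position inside the i-th child).
data Pos : Tree → Set where
  here  : ∀ {ts} → Pos (node ts)
  child : ∀ {ts} (i : Fin (length ts)) → Pos (lookup ts i) → Pos (node ts)

subtree : ∀ {t} → Pos t → Tree
subtree {t} here = t
subtree (child i p) = subtree p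

IsLeaf : ∀ {t} → Pos t → Set
IsLeaf p = subtree p ≡ node []

-- Ancestor relation (reflexive: every node is an ancestor of itself).
data Anc : ∀ {t} → Pos t → Pos t → Set where
  anc-here  : ∀ {ts} {p : Pos (node ts)} → Anc {node ts} here p
  anc-child : ∀ {ts} {i : Fin (length ts)} {p q : Pos (lookup ts i)}
              → Anc {lookup ts i} p q → Anc {node ts} (child i p) (child i q)

IsLCA : ∀ {t} → Pos t → Pos t → Pos t → Set
IsLCA {t} x a b = Anc x a × Anc x b × (∀ (z : Pos t) → Anc z a → Anc z b → Anc z x)

-- x lies on the path from a to b: x is an ancestor of a or of b, and a
-- descendant of every common ancestor of a and b (i.e. of their LCA).
OnPath : ∀ {t} → Pos t → Pos t → Pos t → Set
OnPath {t} x a b = (Anc x a ⊎ Anc x b) × (∀ (z : Pos t) → Anc z a → Anc z b → Anc z x)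

-- Subsets of nodes are predicates; maps S → L are node maps considered on S.
Subset : Tree → Set₁
Subset t = Pos t → Set

InjToLeaves : ∀ {t} → Subset t → (Pos t → Pos t) → Set
InjToLeaves {t} S π =
  (∀ s → S s → IsLeaf (π s)) ×
  (∀ s s' → S s → S s' → π s ≡ π s' → s ≡ s')

Identifies : ∀ {t} → Subset t → (Pos t → Pos t) → (Pos t → Pos t) → Set
Identifies S π σ = ∀ s → S s → IsLCA s (π s) (σ s)

UniqueRequest : ∀ {t} → Subset t → (Pos t → Pos t) → (Pos t → Pos t) → Set
UniqueRequest {t} S π σ =
  ∀ (x s s' : Pos t) → S s → S s' →
  OnPath x (π s) (σ s) → OnPath x (π s') (σ s') → s ≡ s'

Image : ∀ {t} → Subset t → (Pos t → Pos t) → Pos t → Set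
Image {t} S f l = Σ (Pos t) (λ s → S s × f s ≡ l)

SameImage : ∀ {t} → Subset t → (Pos t → Pos t) → (Pos t → Pos t) → Set
SameImage S f g = ∀ l → (Image S f l → Image S g l) × (Image S g l → Image S f l)

{-# OPTIONS --safe #-}
module Submission where

-- Take s ∈ S. Since π(S) = π'(S), the leaf π(s) is π'(s') for some s' ∈ S, so s and
-- s' are both ancestors of that leaf and hence comparable. If s is an ancestor of s',
-- then s' lies on the path from π(s) to σ(s) and on its own path in (π, σ); if s' is
-- an ancestor of s, the same holds with the roles of s, s' and of the two pairs
-- exchanged. Either way unique request forces s = s', so π(s) = π'(s). The claim for
-- σ is the same argument with π and σ exchanged.

open import Defs
open import Data.Product using (_×_; _,_; proj₁)
open import Data.Sum using (_⊎_; inj₁; inj₂)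
open import Relation.Nullary using (¬_)
open import Relation.Binary.PropositionalEquality using (_≡_; refl; sym; trans; cong; subst)

anc-trans : ∀ {t} {a b c : Pos t} → Anc a b → Anc b c → Anc a c
anc-trans anc-here       _              = anc-here
anc-trans (anc-child ab) (anc-child bc) = anc-child (anc-trans ab bc)

anc-comparable : ∀ {t} {a b x : Pos t} → Anc a x → Anc b x → Anc a b ⊎ Anc b a
anc-comparable anc-here       _              = inj₁ anc-here
anc-comparable (anc-child ax) anc-here       = inj₂ anc-here
anc-comparable (anc-child ax) (anc-child bx) with anc-comparable ax bx
... | inj₁ ab = inj₁ (anc-child ab)
... | inj₂ ba = inj₂ (anc-child ba)

module _ {t : Tree} where

  isLCA-sym : {x a b : Pos t} → IsLCA x a b → IsLCA x b a
  isLCA-sym (xa , xb , least) = xb , xa , λ z za zb → least z zb za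

  onPath-sym : {x a b : Pos t} → OnPath x a b → OnPath x b a
  onPath-sym (inj₁ xa , below) = inj₂ xa , λ z za zb → below z zb za
  onPath-sym (inj₂ xb , below) = inj₁ xb , λ z za zb → below z zb za

  isLCA⇒onPath : {x a b : Pos t} → IsLCA x a b → OnPath x a b
  isLCA⇒onPath (xa , _ , least) = inj₁ xa , least

  onPath-between-lca : {x y a b : Pos t} → IsLCA y a b → Anc y x → Anc x a → OnPath x a b
  onPath-between-lca (_ , _ , least) yx xa = inj₁ xa , λ z za zb → anc-trans (least z za zb) yx

  module _ (S : Subset t) (π σ : Pos t → Pos t) where

    identifies-swap : Identifies S π σ → Identifies S σ π
    identifies-swap ident s s∈S = isLCA-sym (ident s s∈S)

    uniqueRequest-swap : UniqueRequest S π σ → UniqueRequest S σ π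
    uniqueRequest-swap unique x s s' s∈S s'∈S x∈path x∈path' =
      unique x s s' s∈S s'∈S (onPath-sym x∈path) (onPath-sym x∈path')

    requester-between-unique :
      Identifies S π σ → UniqueRequest S π σ →
      ∀ {s s'} → S s → S s' → Anc s s' → Anc s' (π s) → s ≡ s'
    requester-between-unique ident unique {s} {s'} s∈S s'∈S ss' s'πs =
      unique s' s s' s∈S s'∈S
        (onPath-between-lca (ident s s∈S) ss' s'πs)
        (isLCA⇒onPath (ident s' s'∈S))

  image⊆⇒agree :
    (S : Subset t) (π σ π' σ' : Pos t → Pos t) →
    Identifies S π σ → UniqueRequest S π σ →
    Identifies S π' σ' → UniqueRequest S π' σ' →
    (∀ l → Image S π l → Image S π' l) →
    ∀ s → S s → π s ≡ π' s
  image⊆⇒agree S π σ π' σ' ident unique ident' unique' π⊆π' s s∈S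
    with π⊆π' (π s) (s , s∈S , refl)
  ... | s' , s'∈S , π's'≡πs = trans (sym π's'≡πs) (cong π' s'≡s)
    where
    s-anc : Anc s (π s)
    s-anc = proj₁ (ident s s∈S)

    s'-anc : Anc s' (π s)
    s'-anc = subst (Anc s') π's'≡πs (proj₁ (ident' s' s'∈S))

    s'≡s : s' ≡ s
    s'≡s with anc-comparable s-anc s'-anc
    ... | inj₁ ss' = sym (requester-between-unique S π σ ident unique s∈S s'∈S ss' s'-anc)
    ... | inj₂ s's =
      requester-between-unique S π' σ' ident' unique' s'∈S s∈S s's
        (subst (Anc s) (sym π's'≡πs) s-anc)

lemma3p4 : (t : Tree) → Full t →
    (S : Subset t) → (∀ s → S s → ¬ IsLeaf s) →
    (π σ π' σ' : Pos t → Pos t) →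
    InjToLeaves S π → InjToLeaves S σ →
    InjToLeaves S π' → InjToLeaves S σ' →
    Identifies S π σ → UniqueRequest S π σ →
    Identifies S π' σ' → UniqueRequest S π' σ' →
    SameImage S π π' → SameImage S σ σ' →
    (∀ s → S s → π s ≡ π' s) × (∀ s → S s → σ s ≡ σ' s)
lemma3p4 t _ S _ π σ π' σ' _ _ _ _ ident unique ident' unique' sameπ sameσ =
  image⊆⇒agree S π σ π' σ' ident unique ident' unique' (λ l → proj₁ (sameπ l)) ,
  image⊆⇒agree S σ π σ' π'
    (identifies-swap S π σ ident) (uniqueRequest-swap S π σ unique)
    (identifies-swap S π' σ' ident') (uniqueRequest-swap S π' σ' unique')
    (λ l → proj₁ (sameσ l))
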